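{- Let $N\ge3$, let $I=\mathbb{Q}[(\mathbb{Z}/N\mathbb{Z})^2]^0$ be the augmentation ideal of the group algebra $\mathbb{Q}[(\mathbb{Z}/N\mathbb{Z})^2]$, and let $\mu:I\otimes I\to I$ be induced by multiplication in the group algebra, $\mu(d_0\otimes d_1)=d_0d_1$. With the action of $H$ and the eigenspace $(I\otimes I)^\varepsilon$ as in the context, $\mu$ restricts to an isomorphism \[ (I\otimes I)^\varepsilon \xrightarrow{\ \cong\ } I. \]
   Context: Let $H=(\mathbb{Z}/N\mathbb{Z})^2\rtimes\{\pm1\}$ ($-1$ acting on $(\mathbb{Z}/N\mathbb{Z})^2$ by negation) and $\varepsilon:H\to\{\pm1\}$ the projection. Write $[u]$ for the basis element of $\mathbb{Q}[(\mathbb{Z}/N\mathbb{Z})^2]$ corresponding to $u$ (so $I$ consists of $\sum\lambda_u[u]$ with $\sum\lambda_u=0$). $H$ acts on $I\otimes I$ by $a\cdot(d_0\otimes d_1)=([a]d_0)\otimes([-a]d_1)$ for $a\in(\mathbb{Z}/N\mathbb{Z})^2$ and $(-1)\cdot(d_0\otimes d_1)=-(d_1\otimes d_0)$. For a $\mathbb{Q}[H]$-module $M$, $M^\varepsilon=\{m\in M: h\cdot m=\varepsilon(h)m \text{ for all } h\in H\}$. -}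

module Defs where

open import Data.Nat as ℕ using (ℕ; zero; suc; _∸_)
open import Data.Nat.DivMod using (_%_; m%n<n)
open import Data.Fin using (Fin; toℕ; fromℕ<) renaming (zero to fz; suc to fs)
open import Data.Product using (_×_; _,_; proj₂)
open import Data.Rational using (ℚ; 0ℚ; 1ℚ; _+_; _*_; -_)
open import Relation.Binary.PropositionalEquality using (_≡_)

-- Arithmetic in ℤ/Nℤ, represented by Fin N (residues 0 … N-1).
_+Z_ : ∀ {N} → Fin N → Fin N → Fin N
_+Z_ {suc n} a b = fromℕ< (m%n<n (toℕ a ℕ.+ toℕ b) (suc n))

-Z_ : ∀ {N} → Fin N → Fin N
-Z_ {suc n} a = fromℕ< (m%n<n (suc n ∸ toℕ a) (suc n))

G : ℕ → Set
G N = Fin N × Fin N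

_+G_ : ∀ {N} → G N → G N → G N
(a , b) +G (c , d) = (a +Z c) , (b +Z d)

-G_ : ∀ {N} → G N → G N
-G (a , b) = (-Z a) , (-Z b)

_-G_ : ∀ {N} → G N → G N → G N
u -G v = u +G (-G v)

sumFin : ∀ {n} → (Fin n → ℚ) → ℚ
sumFin {zero} f = 0ℚ
sumFin {suc n} f = f fz + sumFin (λ i → f (fs i))

sumG : ∀ {N} → (G N → ℚ) → ℚ
sumG f = sumFin (λ i → sumFin (λ j → f (i , j)))

-- The group algebra ℚ[G]: d represents Σ_u d(u) [u].
QG : ℕ → Set
QG N = G N → ℚ

InI : ∀ {N} → QG N → Set
InI d = sumG d ≡ 0ℚ

-- ℚ[G] ⊗ ℚ[G]: f represents Σ_{u,v} f(u,v) [u]⊗[v].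
QG⊗QG : ℕ → Set
QG⊗QG N = G N → G N → ℚ

-- I ⊗ I as a subspace of ℚ[G] ⊗ ℚ[G] (tensor of subspaces):
-- all "row" and "column" augmentations vanish.
InI⊗I : ∀ {N} → QG⊗QG N → Set
InI⊗I f = (∀ v → sumG (λ u → f u v) ≡ 0ℚ) × (∀ u → sumG (λ v → f u v) ≡ 0ℚ)

-- The group H = G ⋊ {±1}; an element (a , s) means a · s.
data Sign : Set where
  plus minus : Sign

H : ℕ → Set
H N = G N × Sign

εS : Sign → ℚ
εS plus = 1ℚ
εS minus = - 1ℚ

ε : ∀ {N} → H N → ℚ
ε (_ , s) = εS s

-- (-1)·(d0 ⊗ d1) = -(d1 ⊗ d0)
actSign : ∀ {N} → Sign → QG⊗QG N → QG⊗QG N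
actSign plus f = f
actSign minus f u v = - f v u

-- a·([u]⊗[v]) = [a+u]⊗[v-a]
actG : ∀ {N} → G N → QG⊗QG N → QG⊗QG N
actG a f u v = f (u -G a) (v +G a)

act : ∀ {N} → H N → QG⊗QG N → QG⊗QG N
act (a , s) f = actG a (actSign s f)

IsEps : ∀ {N} → QG⊗QG N → Set
IsEps {N} f = ∀ (h : H N) u v → act h f u v ≡ ε h * f u v

-- μ([u]⊗[v]) = [u+v]
μ : ∀ {N} → QG⊗QG N → QG N
μ f w = sumG (λ u → f u (w -G u))

-- Write G = (ℤ/Nℤ)², and for d : ℚ[G] let  diag d = Σ_{u,v} d(u+v) [u]⊗[v].
-- The whole proof rests on one observation: invariance under the
-- translations a ∈ G (which act with ε = 1) forces f(u,v) = f(0,u+v), i.e.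
-- every ε-eigenvector is of the form diag d, namely with d = f(0,-).
-- Conversely every diag d is an ε-eigenvector (the sign -1 only swaps u and
-- v, and u+v is symmetric), and since each w ∈ G has exactly |G| = K
-- decompositions w = u+v, we get  μ (diag d) = K · d.  Thus on the
-- eigenspace μ is "multiplication by K on the diagonal function", which is
-- injective since K ≠ 0, and d ↦ diag (d / K) is an inverse; the
-- augmentation conditions match because the row and column sums of diag d
-- are translates of the total sum of d.

module Submission where

open import Defs
open import Data.Nat using (ℕ; _≤_)
open import Data.Product using (_×_; Σ)
open import Data.Rational using (ℚ)
open import Relation.Binary.PropositionalEquality using (_≡_)

open import Data.Nat as ℕ using (zero; suc; _∸_)
open import Data.Nat.DivMod using (_%_; m%n<n; n%n≡0; m%n%n≡m%n; m<n⇒m%n≡m; %-distribˡ-+)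
import Data.Nat.Properties as ℕP
open import Data.Fin using (Fin; toℕ) renaming (zero to fz; suc to fs)
open import Data.Fin.Properties using (toℕ-injective; toℕ-fromℕ<; toℕ<n)
open import Data.Fin.Permutation using (permutation)
open import Data.Product using (_,_)
open import Data.Rational using (0ℚ; 1ℚ; _+_; _*_; -_; 1/_; Positive; NonNegative; NonZero)
import Data.Rational.Properties as ℚP
open import Algebra.Bundles using (CommutativeRing)
import Algebra.Properties.Semiring.Sum as SemiringSum
open import Relation.Binary.PropositionalEquality using (refl; sym; trans; cong; cong₂; module ≡-Reasoning)

-- ℤ/Nℤ is an abelian group (for N = suc n); everything is reduced, via
-- toℕ-injective, to the fact that x % N only depends on x modulo N.
module ZMod (n : ℕ) where
  open ≡-Reasoning

  N : ℕ
  N = suc n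

  toℕ-+Z : (a b : Fin N) → toℕ (a +Z b) ≡ (toℕ a ℕ.+ toℕ b) % N
  toℕ-+Z a b = toℕ-fromℕ< (m%n<n (toℕ a ℕ.+ toℕ b) N)

  toℕ--Z : (a : Fin N) → toℕ (-Z a) ≡ (N ∸ toℕ a) % N
  toℕ--Z a = toℕ-fromℕ< (m%n<n (N ∸ toℕ a) N)

  %-absorbˡ : ∀ x y → (x % N ℕ.+ y) % N ≡ (x ℕ.+ y) % N
  %-absorbˡ x y = begin
    (x % N ℕ.+ y) % N          ≡⟨ %-distribˡ-+ (x % N) y N ⟩
    (x % N % N ℕ.+ y % N) % N  ≡⟨ cong (λ t → (t ℕ.+ y % N) % N) (m%n%n≡m%n x N) ⟩
    (x % N ℕ.+ y % N) % N      ≡⟨ %-distribˡ-+ x y N ⟨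
    (x ℕ.+ y) % N              ∎

  %-absorbʳ : ∀ x y → (x ℕ.+ y % N) % N ≡ (x ℕ.+ y) % N
  %-absorbʳ x y = begin
    (x ℕ.+ y % N) % N  ≡⟨ cong (_% N) (ℕP.+-comm x (y % N)) ⟩
    (y % N ℕ.+ x) % N  ≡⟨ %-absorbˡ y x ⟩
    (y ℕ.+ x) % N      ≡⟨ cong (_% N) (ℕP.+-comm y x) ⟩
    (x ℕ.+ y) % N      ∎

  +Z-comm : (a b : Fin N) → a +Z b ≡ b +Z a
  +Z-comm a b = toℕ-injective (begin
    toℕ (a +Z b)               ≡⟨ toℕ-+Z a b ⟩
    (toℕ a ℕ.+ toℕ b) % N      ≡⟨ cong (_% N) (ℕP.+-comm (toℕ a) (toℕ b)) ⟩
    (toℕ b ℕ.+ toℕ a) % N      ≡⟨ toℕ-+Z b a ⟨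
    toℕ (b +Z a)               ∎)

  +Z-assoc : (a b c : Fin N) → (a +Z b) +Z c ≡ a +Z (b +Z c)
  +Z-assoc a b c = toℕ-injective (begin
    toℕ ((a +Z b) +Z c)                    ≡⟨ toℕ-+Z (a +Z b) c ⟩
    (toℕ (a +Z b) ℕ.+ toℕ c) % N           ≡⟨ cong (λ t → (t ℕ.+ toℕ c) % N) (toℕ-+Z a b) ⟩
    ((toℕ a ℕ.+ toℕ b) % N ℕ.+ toℕ c) % N  ≡⟨ %-absorbˡ (toℕ a ℕ.+ toℕ b) (toℕ c) ⟩
    (toℕ a ℕ.+ toℕ b ℕ.+ toℕ c) % N        ≡⟨ cong (_% N) (ℕP.+-assoc (toℕ a) (toℕ b) (toℕ c)) ⟩
    (toℕ a ℕ.+ (toℕ b ℕ.+ toℕ c)) % N      ≡⟨ %-absorbʳ (toℕ a) (toℕ b ℕ.+ toℕ c) ⟨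
    (toℕ a ℕ.+ (toℕ b ℕ.+ toℕ c) % N) % N  ≡⟨ cong (λ t → (toℕ a ℕ.+ t) % N) (toℕ-+Z b c) ⟨
    (toℕ a ℕ.+ toℕ (b +Z c)) % N           ≡⟨ toℕ-+Z a (b +Z c) ⟨
    toℕ (a +Z (b +Z c))                    ∎)

  +Z-identityʳ : (a : Fin N) → a +Z fz ≡ a
  +Z-identityʳ a = toℕ-injective (begin
    toℕ (a +Z fz)        ≡⟨ toℕ-+Z a fz ⟩
    (toℕ a ℕ.+ 0) % N    ≡⟨ cong (_% N) (ℕP.+-identityʳ (toℕ a)) ⟩
    toℕ a % N            ≡⟨ m<n⇒m%n≡m (toℕ<n a) ⟩
    toℕ a                ∎)

  +Z-inverseʳ : (a : Fin N) → a +Z (-Z a) ≡ fz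
  +Z-inverseʳ a = toℕ-injective (begin
    toℕ (a +Z (-Z a))               ≡⟨ toℕ-+Z a (-Z a) ⟩
    (toℕ a ℕ.+ toℕ (-Z a)) % N       ≡⟨ cong (λ t → (toℕ a ℕ.+ t) % N) (toℕ--Z a) ⟩
    (toℕ a ℕ.+ (N ∸ toℕ a) % N) % N  ≡⟨ %-absorbʳ (toℕ a) (N ∸ toℕ a) ⟩
    (toℕ a ℕ.+ (N ∸ toℕ a)) % N      ≡⟨ cong (_% N) (ℕP.m+[n∸m]≡n (ℕP.<⇒≤ (toℕ<n a))) ⟩
    N % N                            ≡⟨ n%n≡0 N ⟩
    0                                ∎)

  -Z-cancelʳ : (a b : Fin N) → (a +Z (-Z b)) +Z b ≡ a
  -Z-cancelʳ a b = begin
    (a +Z (-Z b)) +Z b  ≡⟨ +Z-assoc a (-Z b) b ⟩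
    a +Z ((-Z b) +Z b)  ≡⟨ cong (a +Z_) (+Z-comm (-Z b) b) ⟩
    a +Z (b +Z (-Z b))  ≡⟨ cong (a +Z_) (+Z-inverseʳ b) ⟩
    a +Z fz             ≡⟨ +Z-identityʳ a ⟩
    a                   ∎

  +Z-cancelʳ : (a b : Fin N) → (a +Z b) +Z (-Z b) ≡ a
  +Z-cancelʳ a b = begin
    (a +Z b) +Z (-Z b)  ≡⟨ +Z-assoc a b (-Z b) ⟩
    a +Z (b +Z (-Z b))  ≡⟨ cong (a +Z_) (+Z-inverseʳ b) ⟩
    a +Z fz             ≡⟨ +Z-identityʳ a ⟩
    a                   ∎

  +Z-shift : (x a y : Fin N) → (x +Z a) +Z (y +Z (-Z a)) ≡ x +Z y
  +Z-shift x a y = begin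
    (x +Z a) +Z (y +Z (-Z a))  ≡⟨ +Z-assoc x a (y +Z (-Z a)) ⟩
    x +Z (a +Z (y +Z (-Z a)))  ≡⟨ cong (x +Z_) (+Z-comm a (y +Z (-Z a))) ⟩
    x +Z ((y +Z (-Z a)) +Z a)  ≡⟨ cong (x +Z_) (-Z-cancelʳ y a) ⟩
    x +Z y                     ∎

module GroupG (n : ℕ) where
  open ZMod n public using (N; -Z-cancelʳ; +Z-cancelʳ)
  open ZMod n using (+Z-comm; +Z-inverseʳ; +Z-shift)

  0G : G N
  0G = fz , fz

  -G-inverseʳ : (u : G N) → u -G u ≡ 0G
  -G-inverseʳ (a , b) = cong₂ _,_ (+Z-inverseʳ a) (+Z-inverseʳ b)

  -G-cancelʳ : (w u : G N) → (w -G u) +G u ≡ w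
  -G-cancelʳ (a , b) (c , d) = cong₂ _,_ (-Z-cancelʳ a c) (-Z-cancelʳ b d)

  +G-comm : (u v : G N) → u +G v ≡ v +G u
  +G-comm (a , b) (c , d) = cong₂ _,_ (+Z-comm a c) (+Z-comm b d)

  +G-shift : (x a y : G N) → (x +G a) +G (y -G a) ≡ x +G y
  +G-shift (a , b) (c , d) (e , f) = cong₂ _,_ (+Z-shift a c e) (+Z-shift b d f)

module ℚSum = SemiringSum (CommutativeRing.semiring ℚP.+-*-commutativeRing)

sumFin≡sum : ∀ {m} (f : Fin m → ℚ) → sumFin f ≡ ℚSum.sum f
sumFin≡sum {zero} f = refl
sumFin≡sum {suc m} f = cong (f fz +_) (sumFin≡sum (λ i → f (fs i)))

sumFin-cong : ∀ {m} {f g : Fin m → ℚ} → (∀ i → f i ≡ g i) → sumFin f ≡ sumFin g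
sumFin-cong {f = f} {g} f≗g = begin
  sumFin f      ≡⟨ sumFin≡sum f ⟩
  ℚSum.sum f    ≡⟨ ℚSum.sum-cong-≗ f≗g ⟩
  ℚSum.sum g    ≡⟨ sumFin≡sum g ⟨
  sumFin g      ∎
  where open ≡-Reasoning

sumFin-scale : ∀ {m} (c : ℚ) (f : Fin m → ℚ) → sumFin (λ i → c * f i) ≡ c * sumFin f
sumFin-scale c f = begin
  sumFin (λ i → c * f i)    ≡⟨ sumFin≡sum (λ i → c * f i) ⟩
  ℚSum.sum (λ i → c * f i)  ≡⟨ ℚSum.*-distribˡ-sum c f ⟨
  c * ℚSum.sum f            ≡⟨ cong (c *_) (sumFin≡sum f) ⟨
  c * sumFin f              ∎
  where open ≡-Reasoning

sumFin-nonNeg : ∀ {m} (f : Fin m → ℚ) → (∀ i → NonNegative (f i)) → NonNegative (sumFin f)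
sumFin-nonNeg {zero} f _ = _
sumFin-nonNeg {suc m} f f≥0 =
  ℚP.nonNeg+nonNeg⇒nonNeg (f fz) {{f≥0 fz}} _ {{sumFin-nonNeg (λ i → f (fs i)) (λ i → f≥0 (fs i))}}

sumFin-pos : ∀ {m} (f : Fin (suc m) → ℚ) → (∀ i → Positive (f i)) → Positive (sumFin f)
sumFin-pos f f>0 = ℚP.pos+nonNeg⇒pos (f fz) {{f>0 fz}} _
  {{sumFin-nonNeg (λ i → f (fs i)) (λ i → ℚP.pos⇒nonNeg (f (fs i)) {{f>0 (fs i)}})}}

sumG-cong : ∀ {N} {f g : G N → ℚ} → (∀ u → f u ≡ g u) → sumG f ≡ sumG g
sumG-cong f≗g = sumFin-cong (λ i → sumFin-cong (λ j → f≗g (i , j)))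

sumG-scale : ∀ {N} (c : ℚ) (f : G N → ℚ) → sumG (λ u → c * f u) ≡ c * sumG f
sumG-scale c f = trans (sumFin-cong (λ i → sumFin-scale c (λ j → f (i , j))))
                       (sumFin-scale c (λ i → sumFin (λ j → f (i , j))))

K : ℕ → ℚ
K N = sumG {N} (λ _ → 1ℚ)

K-positive : ∀ n → Positive (K (suc n))
K-positive n = sumFin-pos {n} (λ _ → sumFin {suc n} (λ _ → 1ℚ)) (λ _ → sumFin-pos {n} (λ _ → 1ℚ) (λ _ → _))

sumG-const : ∀ {N} (x : ℚ) → sumG {N} (λ _ → x) ≡ K N * x
sumG-const {N} x = begin
  sumG {N} (λ _ → x)       ≡⟨ sumG-cong {N} (λ _ → ℚP.*-identityʳ x) ⟨
  sumG {N} (λ _ → x * 1ℚ)  ≡⟨ sumG-scale {N} x (λ _ → 1ℚ) ⟩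
  x * K N                  ≡⟨ ℚP.*-comm x (K N) ⟩
  K N * x                  ∎
  where open ≡-Reasoning

module Translation (n : ℕ) where
  open GroupG n using (N; -Z-cancelʳ; +Z-cancelʳ)

  sumFin-translate : (g : Fin N → ℚ) (a : Fin N) → sumFin (λ i → g (i +Z a)) ≡ sumFin g
  sumFin-translate g a = begin
    sumFin (λ i → g (i +Z a))    ≡⟨ sumFin≡sum (λ i → g (i +Z a)) ⟩
    ℚSum.sum (λ i → g (i +Z a))  ≡⟨ ℚSum.∑-permute g translation ⟨
    ℚSum.sum g                   ≡⟨ sumFin≡sum g ⟨
    sumFin g                     ∎
    where
    open ≡-Reasoning
    translation = permutation (_+Z a) (_+Z (-Z a)) (λ y → -Z-cancelʳ y a) (λ y → +Z-cancelʳ y a)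

  sumG-translate : (g : G N → ℚ) (a : G N) → sumG (λ u → g (u +G a)) ≡ sumG g
  sumG-translate g (a , b) =
    trans (sumFin-cong (λ i → sumFin-translate (λ j → g (i +Z a , j)) b))
          (sumFin-translate (λ i → sumFin (λ j → g (i , j))) a)

module Eigenspace (n : ℕ) where
  open GroupG n
  open Translation n using (sumG-translate)
  open ≡-Reasoning

  instance
    K-nonZero : NonZero (K N)
    K-nonZero = ℚP.pos⇒nonZero (K N) {{K-positive n}}

  K*-injective : ∀ x y → K N * x ≡ K N * y → x ≡ y
  K*-injective x y Kx≡Ky = begin
    x                     ≡⟨ ℚP.*-identityˡ x ⟨
    1ℚ * x                ≡⟨ cong (_* x) (ℚP.*-inverseˡ (K N)) ⟨
    (1/ K N * K N) * x    ≡⟨ ℚP.*-assoc (1/ K N) (K N) x ⟩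
    1/ K N * (K N * x)    ≡⟨ cong (1/ K N *_) Kx≡Ky ⟩
    1/ K N * (K N * y)    ≡⟨ ℚP.*-assoc (1/ K N) (K N) y ⟨
    (1/ K N * K N) * y    ≡⟨ cong (_* y) (ℚP.*-inverseˡ (K N)) ⟩
    1ℚ * y                ≡⟨ ℚP.*-identityˡ y ⟩
    y                     ∎

  K*1/K : ∀ x → K N * (1/ K N * x) ≡ x
  K*1/K x = begin
    K N * (1/ K N * x)    ≡⟨ ℚP.*-assoc (K N) (1/ K N) x ⟨
    (K N * 1/ K N) * x    ≡⟨ cong (_* x) (ℚP.*-inverseʳ (K N)) ⟩
    1ℚ * x                ≡⟨ ℚP.*-identityˡ x ⟩
    x                     ∎

  diag : QG N → QG⊗QG N
  diag d u v = d (v +G u)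

  -- Invariance under the translation by u moves [u]⊗[v] to [0]⊗[u+v], so an
  -- ε-eigenvector is the diagonal tensor of its row at 0.
  eigen⇒diag : (f : QG⊗QG N) → IsEps f → ∀ u v → f u v ≡ diag (f 0G) u v
  eigen⇒diag f f-eigen u v = begin
    f u v                  ≡⟨ ℚP.*-identityˡ (f u v) ⟨
    1ℚ * f u v             ≡⟨ f-eigen (u , plus) u v ⟨
    f (u -G u) (v +G u)    ≡⟨ cong (λ t → f t (v +G u)) (-G-inverseʳ u) ⟩
    f 0G (v +G u)          ∎

  -- Conversely diagonal tensors are ε-eigenvectors: translations preserve
  -- u+v, and the sign only swaps u and v.
  diag-eigen : (d : QG N) → IsEps (diag d)
  diag-eigen d (a , plus) u v = begin
    d ((v +G a) +G (u -G a))  ≡⟨ cong d (+G-shift v a u) ⟩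
    d (v +G u)                ≡⟨ ℚP.*-identityˡ (d (v +G u)) ⟨
    1ℚ * d (v +G u)           ∎
  diag-eigen d (a , minus) u v = begin
    - d ((u -G a) +G (v +G a))  ≡⟨ cong (λ t → - d t) (+G-comm (u -G a) (v +G a)) ⟩
    - d ((v +G a) +G (u -G a))  ≡⟨ cong (λ t → - d t) (+G-shift v a u) ⟩
    - d (v +G u)                ≡⟨ cong -_ (ℚP.*-identityˡ (d (v +G u))) ⟨
    - (1ℚ * d (v +G u))         ≡⟨ ℚP.neg-distribˡ-* 1ℚ (d (v +G u)) ⟩
    - 1ℚ * d (v +G u)           ∎

  -- Each w has exactly K decompositions w = u + v, so μ (diag d) = K · d.
  μ-diag : (d : QG N) → ∀ w → μ (diag d) w ≡ K N * d w
  μ-diag d w = trans (sumG-cong (λ u → cong d (-G-cancelʳ w u))) (sumG-const {N} (d w))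

  μ-eigen : (f : QG⊗QG N) → IsEps f → ∀ w → μ f w ≡ K N * f 0G w
  μ-eigen f f-eigen w =
    trans (sumG-cong (λ u → eigen⇒diag f f-eigen u (w -G u))) (μ-diag (f 0G) w)

  -- The row and column sums of diag d are translates of the sum of d.
  diag-I⊗I : (d : QG N) → InI d → InI⊗I (diag d)
  diag-I⊗I d d∈I = rows , columns
    where
    rows : ∀ v → sumG (λ u → d (v +G u)) ≡ 0ℚ
    rows v = trans (sumG-cong (λ u → cong d (+G-comm v u))) (trans (sumG-translate d v) d∈I)
    columns : ∀ u → sumG (λ v → d (v +G u)) ≡ 0ℚ
    columns u = trans (sumG-translate d u) d∈I

  I-scale : (c : ℚ) (d : QG N) → InI d → InI (λ w → c * d w)
  I-scale c d d∈I = trans (sumG-scale c d) (trans (cong (c *_) d∈I) (ℚP.*-zeroʳ c))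

  μ-maps-into-I : (f : QG⊗QG N) → InI⊗I f → IsEps f → InI (μ f)
  μ-maps-into-I f (_ , columns) f-eigen =
    trans (sumG-cong (μ-eigen f f-eigen)) (I-scale (K N) (f 0G) (columns 0G))

  μ-injective : (f g : QG⊗QG N) → InI⊗I f → IsEps f → InI⊗I g → IsEps g →
                (∀ w → μ f w ≡ μ g w) → ∀ u v → f u v ≡ g u v
  μ-injective f g _ f-eigen _ g-eigen μf≡μg u v = begin
    f u v            ≡⟨ eigen⇒diag f f-eigen u v ⟩
    f 0G (v +G u)    ≡⟨ K*-injective _ _ same-image ⟩
    g 0G (v +G u)    ≡⟨ eigen⇒diag g g-eigen u v ⟨
    g u v            ∎
    where
    same-image : K N * f 0G (v +G u) ≡ K N * g 0G (v +G u)
    same-image = trans (sym (μ-eigen f f-eigen (v +G u)))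
                       (trans (μf≡μg (v +G u)) (μ-eigen g g-eigen (v +G u)))

  μ-surjective : (d : QG N) → InI d →
                 Σ (QG⊗QG N) (λ f → InI⊗I f × IsEps f × (∀ w → μ f w ≡ d w))
  μ-surjective d d∈I =
    diag d/K , diag-I⊗I d/K (I-scale (1/ K N) d d∈I) , diag-eigen d/K ,
    λ w → trans (μ-diag d/K w) (K*1/K (d w))
    where
    d/K : QG N
    d/K w = 1/ K N * d w

lemma5p10 : (N : ℕ) → 3 ≤ N →
    ((f : QG⊗QG N) → InI⊗I f → IsEps f → InI (μ f))
    × ((f g : QG⊗QG N) → InI⊗I f → IsEps f → InI⊗I g → IsEps g →
        (∀ w → μ f w ≡ μ g w) → ∀ u v → f u v ≡ g u v)
    × ((d : QG N) → InI d →
        Σ (QG⊗QG N) (λ f → InI⊗I f × IsEps f × (∀ w → μ f w ≡ d w)))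
lemma5p10 zero ()
lemma5p10 (suc n) _ = μ-maps-into-I , μ-injective , μ-surjective
  where open Eigenspace n
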